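{- Let $X$ be a mixed graph whose underlying graph $\Gamma(X)$ is bipartite and has a unique perfect matching, let $\alpha$ be a complex number with $|\alpha|=1$, and let $H_\alpha$ be the $\alpha$-hermitian adjacency matrix of $X$ (which is invertible). Then for every vertex $i\in V(X)$, $(H_\alpha^{ -1})_{ii}=0$.
   Context: A mixed graph $X$ consists of a finite vertex set $V(X)$, a set $E_0(X)$ of undirected edges (digons) and a set $E_1(X)$ of directed edges (arcs), with no loops and at most one digon or arc between any two distinct vertices. Its underlying graph $\Gamma(X)$ is obtained by forgetting the orientations of the arcs. For a complex number $\alpha$ of modulus $1$, the $\alpha$-hermitian adjacency matrix $H_\alpha(X)=[h_{uv}]$ is defined by $h_{uv}=1$ if $uv\in E_0(X)$, $h_{uv}=\alpha$ if $uv\in E_1(X)$ (arc from $u$ to $v$), $h_{uv}=\overline{\alpha}$ if $vu\in E_1(X)$, and $h_{uv}=0$ otherwise. -}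

module Defs where

open import Level using (Level; _⊔_)
open import Data.Nat using (ℕ; zero; suc)
open import Data.Fin using (Fin; zero; suc; _≟_)
open import Data.Bool using (Bool)
open import Data.Product using (Σ; _×_; ∃)
open import Relation.Nullary using (¬_; yes; no)
open import Relation.Binary.PropositionalEquality using (_≡_)
open import Algebra.Bundles using (CommutativeRing)

-- For an ordered pair (u , v) the relation between u and v is one of:
--   none   : no edge
--   digon  : undirected edge uv ∈ E₀
--   arcOut : arc from u to v   (uv ∈ E₁)
--   arcIn  : arc from v to u   (vu ∈ E₁)
-- At most one digon or arc between two vertices is automatic.

data EdgeKind : Set where
  none digon arcOut arcIn : EdgeKind

reverse : EdgeKind → EdgeKind
reverse none   = none
reverse digon  = digon
reverse arcOut = arcIn
reverse arcIn  = arcOut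

record MixedGraph (n : ℕ) : Set where
  field
    edge      : Fin n → Fin n → EdgeKind
    loopless  : ∀ u → edge u u ≡ none
    symmetric : ∀ u v → edge v u ≡ reverse (edge u v)

open MixedGraph public

Adj : ∀ {n} → MixedGraph n → Fin n → Fin n → Set
Adj X u v = ¬ (edge X u v ≡ none)

Bipartite : ∀ {n} → MixedGraph n → Set
Bipartite {n} X = Σ (Fin n → Bool) λ c → ∀ u v → Adj X u v → ¬ (c u ≡ c v)

-- A perfect matching of Γ(X), encoded as the fixed-point-free involution
-- sending every vertex to its partner; each u is matched by the edge u (m u).
IsPerfectMatching : ∀ {n} → MixedGraph n → (Fin n → Fin n) → Set
IsPerfectMatching X m =
  (∀ u → m (m u) ≡ u) × (∀ u → Adj X u (m u))

HasUniquePerfectMatching : ∀ {n} → MixedGraph n → Set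
HasUniquePerfectMatching {n} X =
  Σ (Fin n → Fin n) λ m → IsPerfectMatching X m ×
    (∀ m' → IsPerfectMatching X m' → ∀ u → m' u ≡ m u)

-- Scalars: a commutative ring with a conjugation (an involutive ring
-- automorphism).  ℂ with complex conjugation is the intended instance.

record Conjugation {c ℓ : Level} (R : CommutativeRing c ℓ) : Set (c ⊔ ℓ) where
  open CommutativeRing R using (Carrier; _≈_; _+_; _*_; 0#; 1#)
  field
    conj          : Carrier → Carrier
    conj-cong     : ∀ {x y} → x ≈ y → conj x ≈ conj y
    conj-+        : ∀ x y → conj (x + y) ≈ conj x + conj y
    conj-*        : ∀ x y → conj (x * y) ≈ conj x * conj y
    conj-1        : conj 1# ≈ 1#
    conj-involutive : ∀ x → conj (conj x) ≈ x

module Matrices {c ℓ : Level} (R : CommutativeRing c ℓ) where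
  open CommutativeRing R using (Carrier; _≈_; _+_; _*_; 0#; 1#)

  Matrix : ℕ → Set c
  Matrix n = Fin n → Fin n → Carrier

  sumF : ∀ {n} → (Fin n → Carrier) → Carrier
  sumF {zero}  f = 0#
  sumF {suc n} f = f zero + sumF (λ i → f (suc i))

  _⊗_ : ∀ {n} → Matrix n → Matrix n → Matrix n
  (A ⊗ B) i j = sumF (λ k → A i k * B k j)

  I : ∀ {n} → Matrix n
  I i j with i ≟ j
  ... | yes _ = 1#
  ... | no  _ = 0#

  _≈ₘ_ : ∀ {n} → Matrix n → Matrix n → Set ℓ
  A ≈ₘ B = ∀ i j → A i j ≈ B i j

  IsInverse : ∀ {n} → Matrix n → Matrix n → Set ℓ
  IsInverse A M = ((A ⊗ M) ≈ₘ I) × ((M ⊗ A) ≈ₘ I)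

  hermAdj : ∀ {n} → Conjugation R → Carrier → MixedGraph n → Matrix n
  hermAdj C α X u v with edge X u v
  ... | none   = 0#
  ... | digon  = 1#
  ... | arcOut = α
  ... | arcIn  = Conjugation.conj C α

{-# OPTIONS --safe #-}
-- Let m be the unique perfect matching and split H = D + E, where D keeps the entries H u (m u).
-- As α ᾱ = 1, D is an involution, so H = D (1 - K) with K = - D E. The (u , v) entry of Kᵏ can only
-- be nonzero if there is an alternating walk u, m u, u₁, m u₁, …, v of k steps. A walk of n steps
-- repeats a vertex, hence contains a simple alternating cycle, and exchanging matched and unmatched
-- edges along that cycle would give a second perfect matching. So Kⁿ = 0 and H has the inverse
-- (1 + K + ⋯ + Kⁿ⁻¹) D.
-- If P and Q project onto the two colour classes, bipartiteness says P H = H Q, so every inverse M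
-- satisfies M P = Q M, whose diagonal reads Mᵢᵢ [i ∈ P] = [i ∈ Q] Mᵢᵢ and forces Mᵢᵢ = 0. Unlike the
-- usual argument via J H J = - H, this never divides by 2.
module Submission where

open import Defs
open import Level using (Level)
open import Data.Nat using (ℕ; zero; suc; pred; _<_; _≤_; s≤s; z≤n; >-nonZero)
open import Data.Nat.Properties
  using (≤-refl; <⇒≤; <⇒≢; <-≤-trans; n<1+n; m≤n⇒m≤1+n; m≤n⇒m<n∨m≡n; m<1+n⇒m<n∨m≡n; suc-injective; 0≢1+n;
         suc-pred; +-cancelʳ-≡; +-monoˡ-<; m∸n+n≡m; m<n⇒0<n∸m; anyUpTo?)
open import Data.Fin as Fin using (Fin; _≟_; punchIn; toℕ)
open import Data.Fin.Properties using (punchInᵢ≢i; pigeonhole; toℕ<n)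
open import Data.Bool as Bool using (Bool; true; false; not)
open import Data.Bool.Properties using (¬-not)
open import Data.Product using (Σ; ∃; ∃₂; _×_; _,_; proj₁; proj₂)
open import Data.Sum using (_⊎_; inj₁; inj₂)
open import Data.Empty using (⊥-elim)
open import Relation.Nullary using (¬_; ¬?; Dec; yes; no)
open import Relation.Nullary.Decidable using (_×-dec_; decidable-stable)
open import Relation.Binary.PropositionalEquality as ≡ using (_≡_; _≢_)
open import Relation.Binary.Definitions using (DecidableEquality)
open import Algebra.Bundles using (Ring; Semiring; CommutativeRing)
import Algebra.Construct.Pointwise as Pointwise

module RingInverses {c ℓ : Level} (R : Ring c ℓ) where
  open Ring R
  open import Algebra.Properties.Ring R using (-‿involutive; -‿distribˡ-*; -‿distribʳ-*)
  open import Algebra.Definitions.RawSemiring (Semiring.rawSemiring semiring) public using (_^_)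
  open import Relation.Binary.Reasoning.Setoid setoid

  Inverses : Carrier → Carrier → Set ℓ
  Inverses x y = (x * y ≈ 1#) × (y * x ≈ 1#)

  Inverses-cong : ∀ {x y z} → x ≈ y → Inverses x z → Inverses y z
  Inverses-cong x≈y (xz , zx) = trans (*-congʳ (sym x≈y)) xz , trans (*-congˡ (sym x≈y)) zx

  Inverses-* : ∀ {a a′ b b′} → Inverses a a′ → Inverses b b′ → Inverses (a * b) (b′ * a′)
  Inverses-* {a} {a′} {b} {b′} (aa′ , a′a) (bb′ , b′b) = cancel a b b′ a′ bb′ aa′ , cancel b′ a′ a b a′a b′b
    where
    cancel : ∀ x y y′ x′ → y * y′ ≈ 1# → x * x′ ≈ 1# → (x * y) * (y′ * x′) ≈ 1#
    cancel x y y′ x′ yy′ xx′ = begin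
      (x * y) * (y′ * x′) ≈⟨ *-assoc x y (y′ * x′) ⟩
      x * (y * (y′ * x′)) ≈⟨ *-congˡ (*-assoc y y′ x′) ⟨
      x * ((y * y′) * x′) ≈⟨ *-congˡ (*-congʳ yy′) ⟩
      x * (1# * x′)       ≈⟨ *-congˡ (*-identityˡ x′) ⟩
      x * x′              ≈⟨ xx′ ⟩
      1#                  ∎

  inverse-intertwines : ∀ {h g p q} → Inverses h g → p * h ≈ h * q → g * p ≈ q * g
  inverse-intertwines {h} {g} {p} {q} (hg , gh) ph≈hq = begin
    g * p               ≈⟨ *-identityʳ (g * p) ⟨
    g * p * 1#          ≈⟨ *-congˡ hg ⟨
    g * p * (h * g)     ≈⟨ *-assoc (g * p) h g ⟨
    g * p * h * g       ≈⟨ *-congʳ (*-assoc g p h) ⟩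
    g * (p * h) * g     ≈⟨ *-congʳ (*-congˡ ph≈hq) ⟩
    g * (h * q) * g     ≈⟨ *-congʳ (*-assoc g h q) ⟨
    g * h * q * g       ≈⟨ *-congʳ (*-congʳ gh) ⟩
    1# * q * g          ≈⟨ *-congʳ (*-identityˡ q) ⟩
    q * g               ∎

  geometric : Carrier → ℕ → Carrier
  geometric x zero    = 0#
  geometric x (suc k) = 1# + x * geometric x k

  geometric-telescope : ∀ x k → geometric x k + x ^ k ≈ 1# + x * geometric x k
  geometric-telescope x zero = begin
    0# + 1#     ≈⟨ +-identityˡ 1# ⟩
    1#          ≈⟨ +-identityʳ 1# ⟨
    1# + 0#     ≈⟨ +-congˡ (zeroʳ x) ⟨
    1# + x * 0# ∎
  geometric-telescope x (suc k) = begin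
    (1# + x * g) + x * x ^ k ≈⟨ +-assoc 1# (x * g) (x * x ^ k) ⟩
    1# + (x * g + x * x ^ k) ≈⟨ +-congˡ (distribˡ x g (x ^ k)) ⟨
    1# + x * (g + x ^ k)     ≈⟨ +-congˡ (*-congˡ (geometric-telescope x k)) ⟩
    1# + x * (1# + x * g)    ∎
    where g = geometric x k

  geometric-comm : ∀ x k → x * geometric x k ≈ geometric x k * x
  geometric-comm x zero = trans (zeroʳ x) (sym (zeroˡ x))
  geometric-comm x (suc k) = begin
    x * (1# + x * g)       ≈⟨ distribˡ x 1# (x * g) ⟩
    x * 1# + x * (x * g)   ≈⟨ +-cong (*-identityʳ x) (*-congˡ (geometric-comm x k)) ⟩
    x + x * (g * x)        ≈⟨ +-cong (*-identityˡ x) (*-assoc x g x) ⟨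
    1# * x + (x * g) * x   ≈⟨ distribʳ x 1# (x * g) ⟨
    (1# + x * g) * x       ∎
    where g = geometric x k

  geometric-inverse : ∀ {x} k → x ^ k ≈ 0# → Inverses (1# - x) (geometric x k)
  geometric-inverse {x} k xᵏ≈0 = left , right
    where
    g = geometric x k

    g≈1+xg : g ≈ 1# + x * g
    g≈1+xg = trans (sym (trans (+-congˡ xᵏ≈0) (+-identityʳ g))) (geometric-telescope x k)

    g-xg≈1 : g - x * g ≈ 1#
    g-xg≈1 = begin
      g - x * g                ≈⟨ +-congʳ g≈1+xg ⟩
      (1# + x * g) - x * g     ≈⟨ +-assoc 1# (x * g) (- (x * g)) ⟩
      1# + (x * g - x * g)     ≈⟨ +-congˡ (-‿inverseʳ (x * g)) ⟩
      1# + 0#                  ≈⟨ +-identityʳ 1# ⟩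
      1#                       ∎

    left : (1# - x) * g ≈ 1#
    left = begin
      (1# - x) * g       ≈⟨ distribʳ g 1# (- x) ⟩
      1# * g + - x * g   ≈⟨ +-cong (*-identityˡ g) (sym (-‿distribˡ-* x g)) ⟩
      g - x * g          ≈⟨ g-xg≈1 ⟩
      1#                 ∎

    right : g * (1# - x) ≈ 1#
    right = begin
      g * (1# - x)       ≈⟨ distribˡ g 1# (- x) ⟩
      g * 1# + g * - x   ≈⟨ +-cong (*-identityʳ g) (sym (-‿distribʳ-* g x)) ⟩
      g - g * x          ≈⟨ +-congˡ (-‿cong (geometric-comm x k)) ⟨
      g - x * g          ≈⟨ g-xg≈1 ⟩
      1#                 ∎

  involution+nilpotent⇒invertible : ∀ {d e} k → d * d ≈ 1# → (- (d * e)) ^ k ≈ 0# →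
    Inverses (d + e) (geometric (- (d * e)) k * d)
  involution+nilpotent⇒invertible {d} {e} k dd≈1 nilpotent =
    Inverses-cong factorisation (Inverses-* (dd≈1 , dd≈1) (geometric-inverse k nilpotent))
    where
    factorisation : d * (1# - - (d * e)) ≈ d + e
    factorisation = begin
      d * (1# - - (d * e))    ≈⟨ *-congˡ (+-congˡ (-‿involutive (d * e))) ⟩
      d * (1# + d * e)        ≈⟨ distribˡ d 1# (d * e) ⟩
      d * 1# + d * (d * e)    ≈⟨ +-cong (*-identityʳ d) (sym (*-assoc d d e)) ⟩
      d + (d * d) * e         ≈⟨ +-congˡ (trans (*-congʳ dd≈1) (*-identityˡ e)) ⟩
      d + e                   ∎

Walk : {A : Set} → (A → A → Set) → ℕ → A → A → Set
Walk {A} S k u v = Σ (ℕ → A) λ w → w 0 ≡ u × w k ≡ v × (∀ {t} → t < k → S (w t) (w (suc t)))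

walk-∷ : ∀ {A : Set} {S : A → A → Set} {k u x v} → S u x → Walk S k x v → Walk S (suc k) u v
walk-∷ {A} {S} {k} {u} s (w , w0≡x , wk≡v , steps) = w′ , ≡.refl , wk≡v , steps′
  where
  w′ : ℕ → A
  w′ zero    = u
  w′ (suc t) = w t
  steps′ : ∀ {t} → t < suc k → S (w′ t) (w′ (suc t))
  steps′ {zero}  _         = ≡.subst (S u) (≡.sym w0≡x) s
  steps′ {suc t} (s≤s t<k) = steps t<k

module _ {A : Set} where

  InjectiveBelow : (ℕ → A) → ℕ → Set
  InjectiveBelow f k = ∀ {a b} → a < k → b < k → f a ≡ f b → a ≡ b

  FirstRepetition : (ℕ → A) → ℕ → Set
  FirstRepetition f k = ∃₂ λ i j → i < j × j ≤ k × f i ≡ f j × InjectiveBelow f j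

  injectiveBelow⊎firstRepetition : DecidableEquality A → (f : ℕ → A) → ∀ k →
    InjectiveBelow f (suc k) ⊎ FirstRepetition f k
  injectiveBelow⊎firstRepetition _≟ₐ_ f zero = inj₁ λ { (s≤s z≤n) (s≤s z≤n) _ → ≡.refl }
  injectiveBelow⊎firstRepetition _≟ₐ_ f (suc k) with injectiveBelow⊎firstRepetition _≟ₐ_ f k
  ... | inj₂ (i , j , i<j , j≤k , fi≡fj , injective) = inj₂ (i , j , i<j , m≤n⇒m≤1+n j≤k , fi≡fj , injective)
  ... | inj₁ injective with anyUpTo? (λ i → f i ≟ₐ f (suc k)) (suc k)
  ...   | yes (i , i≤k , fi≡fk) = inj₂ (i , suc k , i≤k , ≤-refl , fi≡fk , injective)
  ...   | no fresh = inj₁ injective′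
    where
    injective′ : InjectiveBelow f (suc (suc k))
    injective′ a< b< fa≡fb with m<1+n⇒m<n∨m≡n a< | m<1+n⇒m<n∨m≡n b<
    ... | inj₁ a≤k    | inj₁ b≤k    = injective a≤k b≤k fa≡fb
    ... | inj₂ a≡1+k  | inj₂ b≡1+k  = ≡.trans a≡1+k (≡.sym b≡1+k)
    ... | inj₁ a≤k    | inj₂ ≡.refl = ⊥-elim (fresh (_ , a≤k , fa≡fb))
    ... | inj₂ ≡.refl | inj₁ b≤k    = ⊥-elim (fresh (_ , b≤k , ≡.sym fa≡fb))

¬injectiveBelow-suc : ∀ {n} (f : ℕ → Fin n) → ¬ InjectiveBelow f (suc n)
¬injectiveBelow-suc {n} f injective with pigeonhole (n<1+n n) (λ i → f (toℕ i))
... | i , j , i<j , fi≡fj = <⇒≢ i<j (injective (toℕ<n i) (toℕ<n j) fi≡fj)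

record SimpleCycle {A : Set} (S : A → A → Set) : Set where
  field
    length   : ℕ
    vertex   : ℕ → A
    nonempty : 0 < length
    closed   : vertex length ≡ vertex 0
    step     : ∀ {t} → t < length → S (vertex t) (vertex (suc t))
    simple   : InjectiveBelow vertex length

walk⇒simpleCycle : ∀ {n} {S : Fin n → Fin n → Set} {u v} → Walk S n u v → SimpleCycle S
walk⇒simpleCycle {n} (w , _ , _ , steps) with injectiveBelow⊎firstRepetition _≟_ w n
... | inj₁ injective = ⊥-elim (¬injectiveBelow-suc w injective)
... | inj₂ (i , j , i<j , j≤n , wi≡wj , injective) = record
  { length   = j ∸ i
  ; vertex   = λ t → w (t + i)   -- not i + t: this way vertex (suc t) reduces to w (suc (t + i))
  ; nonempty = m<n⇒0<n∸m i<j
  ; closed   = ≡.trans (≡.cong w j∸i+i≡j) (≡.sym wi≡wj)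
  ; step     = λ t< → steps (<-≤-trans (shift t<) j≤n)
  ; simple   = λ a< b< e → +-cancelʳ-≡ i _ _ (injective (shift a<) (shift b<) e)
  }
  where
  open Data.Nat using (_+_; _∸_)
  j∸i+i≡j : j ∸ i + i ≡ j
  j∸i+i≡j = m∸n+n≡m (<⇒≤ i<j)
  shift : ∀ {t} → t < j ∸ i → t + i < j
  shift {t} t< = ≡.subst (t + i <_) j∸i+i≡j (+-monoˡ-< i t<)

module MatrixAlgebra {c ℓ : Level} (R : CommutativeRing c ℓ) where
  open CommutativeRing R
  open Matrices R
  open import Algebra.Properties.Semiring.Sum semiring
    using (sum; sum-cong-≋; sum-cong-≗; sum-remove; sum-replicate-zero; ∑-comm; ∑-distrib-+; *-distribˡ-sum; *-distribʳ-sum)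
  open import Relation.Binary.Reasoning.Setoid setoid

  sumF≡sum : ∀ {n} (f : Fin n → Carrier) → sumF f ≡ sum f
  sumF≡sum {zero}  f = ≡.refl
  sumF≡sum {suc n} f = ≡.cong (f Fin.zero +_) (sumF≡sum (λ i → f (Fin.suc i)))

  sum-zero : ∀ {n} {f : Fin n → Carrier} → (∀ i → f i ≈ 0#) → sum f ≈ 0#
  sum-zero {n} f≈0 = trans (sum-cong-≋ f≈0) (sum-replicate-zero n)

  sum-delta : ∀ {n} {f : Fin n → Carrier} i → (∀ j → ¬ j ≡ i → f j ≈ 0#) → sum f ≈ f i
  sum-delta {suc n} {f} i f≈0 = begin
    sum f                                  ≈⟨ sum-remove f ⟩
    f i + sum (λ j → f (punchIn i j))      ≈⟨ +-congˡ (sum-zero (λ j → f≈0 (punchIn i j) (punchInᵢ≢i i j))) ⟩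
    f i + 0#                               ≈⟨ +-identityʳ (f i) ⟩
    f i                                    ∎

  ⊗-sum : ∀ {n} (A B : Matrix n) i j → (A ⊗ B) i j ≡ sum (λ k → A i k * B k j)
  ⊗-sum A B i j = sumF≡sum (λ k → A i k * B k j)

  I-diagonal : ∀ {n} (i : Fin n) → I i i ≈ 1#
  I-diagonal i with i ≟ i
  ... | yes _  = refl
  ... | no i≢i = ⊥-elim (i≢i ≡.refl)

  I-off-diagonal : ∀ {n} {i j : Fin n} → ¬ i ≡ j → I i j ≈ 0#
  I-off-diagonal {i = i} {j} i≢j with i ≟ j
  ... | yes i≡j = ⊥-elim (i≢j i≡j)
  ... | no _    = refl

  ⊗-sparseˡ : ∀ {n} (A B : Matrix n) {i} k → (∀ l → ¬ l ≡ k → A i l ≈ 0#) →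
              ∀ j → (A ⊗ B) i j ≈ A i k * B k j
  ⊗-sparseˡ A B {i} k A≈0 j = begin
    (A ⊗ B) i j                ≡⟨ ⊗-sum A B i j ⟩
    sum (λ l → A i l * B l j)  ≈⟨ sum-delta k (λ l l≢k → trans (*-congʳ (A≈0 l l≢k)) (zeroˡ (B l j))) ⟩
    A i k * B k j              ∎

  ⊗-sparseʳ : ∀ {n} (A B : Matrix n) {j} k → (∀ l → ¬ l ≡ k → B l j ≈ 0#) →
              ∀ i → (A ⊗ B) i j ≈ A i k * B k j
  ⊗-sparseʳ A B {j} k B≈0 i = begin
    (A ⊗ B) i j                ≡⟨ ⊗-sum A B i j ⟩
    sum (λ l → A i l * B l j)  ≈⟨ sum-delta k (λ l l≢k → trans (*-congˡ (B≈0 l l≢k)) (zeroʳ (A i l))) ⟩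
    A i k * B k j              ∎

  ⊗-identityˡ : ∀ {n} (A : Matrix n) → (I ⊗ A) ≈ₘ A
  ⊗-identityˡ A i j = trans (⊗-sparseˡ I A {i} i (λ l l≢i → I-off-diagonal (λ i≡l → l≢i (≡.sym i≡l))) j)
                            (trans (*-congʳ (I-diagonal i)) (*-identityˡ (A i j)))

  ⊗-identityʳ : ∀ {n} (A : Matrix n) → (A ⊗ I) ≈ₘ A
  ⊗-identityʳ A i j = trans (⊗-sparseʳ A I j (λ l → I-off-diagonal) i)
                            (trans (*-congˡ (I-diagonal j)) (*-identityʳ (A i j)))

  ⊗-cong : ∀ {n} {A A′ B B′ : Matrix n} → A ≈ₘ A′ → B ≈ₘ B′ → (A ⊗ B) ≈ₘ (A′ ⊗ B′)
  ⊗-cong {A = A} {A′} {B} {B′} A≈A′ B≈B′ i j = begin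
    (A ⊗ B) i j                   ≡⟨ ⊗-sum A B i j ⟩
    sum (λ k → A i k * B k j)     ≈⟨ sum-cong-≋ (λ k → *-cong (A≈A′ i k) (B≈B′ k j)) ⟩
    sum (λ k → A′ i k * B′ k j)   ≡⟨ ⊗-sum A′ B′ i j ⟨
    (A′ ⊗ B′) i j                 ∎

  ⊗-assoc : ∀ {n} (A B C : Matrix n) → ((A ⊗ B) ⊗ C) ≈ₘ (A ⊗ (B ⊗ C))
  ⊗-assoc A B C i j = begin
    ((A ⊗ B) ⊗ C) i j
      ≡⟨ ⊗-sum (A ⊗ B) C i j ⟩
    sum (λ k → (A ⊗ B) i k * C k j)
      ≡⟨ sum-cong-≗ (λ k → ≡.cong (_* C k j) (⊗-sum A B i k)) ⟩
    sum (λ k → sum (λ l → A i l * B l k) * C k j)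
      ≈⟨ sum-cong-≋ (λ k → *-distribʳ-sum (C k j) (λ l → A i l * B l k)) ⟩
    sum (λ k → sum (λ l → A i l * B l k * C k j))
      ≈⟨ ∑-comm (λ k l → A i l * B l k * C k j) ⟩
    sum (λ l → sum (λ k → A i l * B l k * C k j))
      ≈⟨ sum-cong-≋ (λ l → sum-cong-≋ (λ k → *-assoc (A i l) (B l k) (C k j))) ⟩
    sum (λ l → sum (λ k → A i l * (B l k * C k j)))
      ≈⟨ sum-cong-≋ (λ l → *-distribˡ-sum (A i l) (λ k → B l k * C k j)) ⟨
    sum (λ l → A i l * sum (λ k → B l k * C k j))
      ≡⟨ sum-cong-≗ (λ l → ≡.cong (A i l *_) (⊗-sum B C l j)) ⟨
    sum (λ l → A i l * (B ⊗ C) l j)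
      ≡⟨ ⊗-sum A (B ⊗ C) i j ⟨
    (A ⊗ (B ⊗ C)) i j
      ∎

  _⊕_ : ∀ {n} → Matrix n → Matrix n → Matrix n
  (A ⊕ B) i j = A i j + B i j

  ⊗-distribˡ : ∀ {n} (A B C : Matrix n) → (A ⊗ (B ⊕ C)) ≈ₘ ((A ⊗ B) ⊕ (A ⊗ C))
  ⊗-distribˡ A B C i j = begin
    (A ⊗ (B ⊕ C)) i j                                     ≡⟨ ⊗-sum A (B ⊕ C) i j ⟩
    sum (λ k → A i k * (B k j + C k j))                   ≈⟨ sum-cong-≋ (λ k → distribˡ (A i k) (B k j) (C k j)) ⟩
    sum (λ k → A i k * B k j + A i k * C k j)             ≈⟨ ∑-distrib-+ (λ k → A i k * B k j) (λ k → A i k * C k j) ⟩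
    sum (λ k → A i k * B k j) + sum (λ k → A i k * C k j) ≡⟨ ≡.cong₂ _+_ (⊗-sum A B i j) (⊗-sum A C i j) ⟨
    (A ⊗ B) i j + (A ⊗ C) i j                             ∎

  ⊗-distribʳ : ∀ {n} (A B C : Matrix n) → ((B ⊕ C) ⊗ A) ≈ₘ ((B ⊗ A) ⊕ (C ⊗ A))
  ⊗-distribʳ A B C i j = begin
    ((B ⊕ C) ⊗ A) i j                                     ≡⟨ ⊗-sum (B ⊕ C) A i j ⟩
    sum (λ k → (B i k + C i k) * A k j)                   ≈⟨ sum-cong-≋ (λ k → distribʳ (A k j) (B i k) (C i k)) ⟩
    sum (λ k → B i k * A k j + C i k * A k j)             ≈⟨ ∑-distrib-+ (λ k → B i k * A k j) (λ k → C i k * A k j) ⟩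
    sum (λ k → B i k * A k j) + sum (λ k → C i k * A k j) ≡⟨ ≡.cong₂ _+_ (⊗-sum B A i j) (⊗-sum C A i j) ⟨
    (B ⊗ A) i j + (C ⊗ A) i j                             ∎

  matrixRing : ℕ → Ring c ℓ
  matrixRing n = record
    { Carrier = Matrix n
    ; _≈_     = _≈ₘ_
    ; _+_     = _⊕_
    ; _*_     = _⊗_
    ; -_      = λ A i j → - A i j
    ; 0#      = λ _ _ → 0#
    ; 1#      = I
    ; isRing  = record
      { +-isAbelianGroup = Pointwise.isAbelianGroup (Fin n) (Pointwise.isAbelianGroup (Fin n) +-isAbelianGroup)
      ; *-cong           = ⊗-cong
      ; *-assoc          = ⊗-assoc
      ; *-identity       = ⊗-identityˡ , ⊗-identityʳ
      ; distrib          = ⊗-distribˡ , ⊗-distribʳ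
      }
    }

  open module MatrixInverses {n : ℕ} = RingInverses (matrixRing n) public
    using (_^_; Inverses-cong; inverse-intertwines; geometric; involution+nilpotent⇒invertible)

  VanishesOff : ∀ {n} → Matrix n → (Fin n → Fin n → Set) → Set ℓ
  VanishesOff A S = ∀ {u v} → ¬ S u v → A u v ≈ 0#

  ^-vanishes-off-walks : ∀ {n} {K : Matrix n} {S : Fin n → Fin n → Set} →
    (∀ u v → Dec (S u v)) → VanishesOff K S → ∀ k → VanishesOff (K ^ k) (Walk S k)
  ^-vanishes-off-walks S? K≈0 zero {u} {v} ¬walk =
    I-off-diagonal (λ u≡v → ¬walk ((λ _ → u) , ≡.refl , u≡v , λ ()))
  ^-vanishes-off-walks {K = K} {S} S? K≈0 (suc k) {u} {v} ¬walk = begin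
    (K ⊗ (K ^ k)) u v                 ≡⟨ ⊗-sum K (K ^ k) u v ⟩
    sum (λ x → K u x * (K ^ k) x v)  ≈⟨ sum-zero term≈0 ⟩
    0#                               ∎
    where
    term≈0 : ∀ x → K u x * (K ^ k) x v ≈ 0#
    term≈0 x with S? u x
    ... | yes s  = trans (*-congˡ (^-vanishes-off-walks S? K≈0 k (λ walk → ¬walk (walk-∷ s walk)))) (zeroʳ (K u x))
    ... | no ¬s  = trans (*-congʳ (K≈0 ¬s)) (zeroˡ ((K ^ k) x v))

  diag : ∀ {n} → (Fin n → Carrier) → Matrix n
  diag d i j = d i * I i j

  diag-diagonal : ∀ {n} (d : Fin n → Carrier) i → diag d i i ≈ d i
  diag-diagonal d i = trans (*-congˡ (I-diagonal i)) (*-identityʳ (d i))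

  diag-off-diagonal : ∀ {n} (d : Fin n → Carrier) {i j} → ¬ i ≡ j → diag d i j ≈ 0#
  diag-off-diagonal d {i} i≢j = trans (*-congˡ (I-off-diagonal i≢j)) (zeroʳ (d i))

  diag-⊗ : ∀ {n} (d : Fin n → Carrier) (A : Matrix n) i j → (diag d ⊗ A) i j ≈ d i * A i j
  diag-⊗ d A i j = trans (⊗-sparseˡ (diag d) A {i} i (λ l l≢i → diag-off-diagonal d (λ i≡l → l≢i (≡.sym i≡l))) j)
                         (*-congʳ (diag-diagonal d i))

  ⊗-diag : ∀ {n} (A : Matrix n) (d : Fin n → Carrier) i j → (A ⊗ diag d) i j ≈ A i j * d j
  ⊗-diag A d i j = trans (⊗-sparseʳ A (diag d) j (λ l → diag-off-diagonal d) i) (*-congˡ (diag-diagonal d j))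

  indicator : Bool → Carrier
  indicator true  = 1#
  indicator false = 0#

  x*[b]≈[¬b]*x⇒x≈0 : ∀ b {x} → x * indicator b ≈ indicator (not b) * x → x ≈ 0#
  x*[b]≈[¬b]*x⇒x≈0 true  {x} eq = trans (sym (*-identityʳ x)) (trans eq (zeroˡ x))
  x*[b]≈[¬b]*x⇒x≈0 false {x} eq = trans (sym (*-identityˡ x)) (trans (sym eq) (zeroʳ x))

  Separates : ∀ {n} → (Fin n → Bool) → Fin n → Fin n → Set
  Separates p i j = p i ≢ p j

  inverse-vanishes-off-separated : ∀ {n} {A M : Matrix n} (p : Fin n → Bool) →
    VanishesOff A (Separates p) → IsInverse A M → VanishesOff M (Separates p)
  inverse-vanishes-off-separated {n} {A} {M} p A≈0 A⁻¹ {i} {j} ¬sep =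
    x*[b]≈[¬b]*x⇒x≈0 (p j) (trans MP≈QM (*-congʳ (reflexive (≡.cong (λ b → indicator (not b)) pi≡pj))))
    where
    [p] [¬p] : Fin n → Carrier
    [p] k  = indicator (p k)
    [¬p] k = indicator (not (p k))

    P Q : Matrix n
    P = diag [p]
    Q = diag [¬p]

    pi≡pj : p i ≡ p j
    pi≡pj = decidable-stable (p i Bool.≟ p j) ¬sep

    [p]A≈A[¬p] : ∀ k l → [p] k * A k l ≈ A k l * [¬p] l
    [p]A≈A[¬p] k l with p k Bool.≟ p l
    ... | yes pk≡pl = trans (*-congˡ Akl≈0) (trans (zeroʳ ([p] k)) (sym (trans (*-congʳ Akl≈0) (zeroˡ ([¬p] l)))))
      where
      Akl≈0 : A k l ≈ 0#
      Akl≈0 = A≈0 (λ separated → separated pk≡pl)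
    ... | no pk≢pl  = trans (*-comm ([p] k) (A k l)) (*-congˡ (reflexive (≡.cong indicator (¬-not pk≢pl))))

    PA≈AQ : (P ⊗ A) ≈ₘ (A ⊗ Q)
    PA≈AQ k l = trans (diag-⊗ [p] A k l) (trans ([p]A≈A[¬p] k l) (sym (⊗-diag A [¬p] k l)))

    MP≈QM : M i j * indicator (p j) ≈ indicator (not (p i)) * M i j
    MP≈QM = trans (sym (⊗-diag M [p] i j)) (trans (inverse-intertwines A⁻¹ PA≈AQ i j) (diag-⊗ [¬p] M i j))

module _ {n : ℕ} (X : MixedGraph n) where

  adjacent? : ∀ u v → Dec (Adj X u v)
  adjacent? u v with edge X u v
  ... | none   = no λ ¬none → ¬none ≡.refl
  ... | digon  = yes λ ()
  ... | arcOut = yes λ ()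
  ... | arcIn  = yes λ ()

  Adj-sym : ∀ {u v} → Adj X u v → Adj X v u
  Adj-sym {u} {v} uv vu≡none = uv (reverse-none (≡.trans (≡.sym (symmetric X u v)) vu≡none))
    where
    reverse-none : ∀ {e} → reverse e ≡ none → e ≡ none
    reverse-none {none} _ = ≡.refl

  AlternatingStep : (Fin n → Fin n) → Fin n → Fin n → Set
  AlternatingStep m u v = v ≢ u × Adj X (m u) v

module AlternatingCycles {n : ℕ} (X : MixedGraph n) (bipartite : Bipartite X)
  (m : Fin n → Fin n) (matching : IsPerfectMatching X m)
  (unique : ∀ m′ → IsPerfectMatching X m′ → ∀ u → m′ u ≡ m u) where

  colour : Fin n → Bool
  colour = proj₁ bipartite

  proper : ∀ u v → Adj X u v → colour u ≢ colour v
  proper = proj₂ bipartite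

  m-involutive : ∀ u → m (m u) ≡ u
  m-involutive = proj₁ matching

  m-adjacent : ∀ u → Adj X u (m u)
  m-adjacent = proj₂ matching

  m-injective : ∀ {a b} → m a ≡ m b → a ≡ b
  m-injective {a} {b} ma≡mb = ≡.trans (≡.sym (m-involutive a)) (≡.trans (≡.cong m ma≡mb) (m-involutive b))

  alternatingStep-colour : ∀ {u v} → AlternatingStep X m u v → colour v ≡ colour u
  alternatingStep-colour {u} (_ , muv) =
    ≡.trans (¬-not (λ e → proper _ _ muv (≡.sym e))) (≡.sym (¬-not (proper u (m u) (m-adjacent u))))

  module Exchange (cycle : SimpleCycle (AlternatingStep X m)) where
    open SimpleCycle cycle renaming (vertex to h; length to L)

    colour-along : ∀ {t} → t ≤ L → colour (h t) ≡ colour (h 0)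
    colour-along {zero}  _   = ≡.refl
    colour-along {suc t} t<L = ≡.trans (alternatingStep-colour (step t<L)) (colour-along (<⇒≤ t<L))

    Partner Successor : Fin n → Set
    Partner x   = ∃ λ t → t < L × x ≡ m (h t)
    Successor x = ∃ λ t → t < L × x ≡ h (suc t)

    partner-injective : ∀ {s t} → s < L → t < L → m (h s) ≡ m (h t) → s ≡ t
    partner-injective s<L t<L e = simple s<L t<L (m-injective e)

    successor-injective : ∀ {s t} → s < L → t < L → h (suc s) ≡ h (suc t) → s ≡ t
    successor-injective {s} {t} s<L t<L e with m≤n⇒m<n∨m≡n s<L | m≤n⇒m<n∨m≡n t<L
    ... | inj₁ 1+s<L | inj₁ 1+t<L = suc-injective (simple 1+s<L 1+t<L e)
    ... | inj₂ 1+s≡L | inj₂ 1+t≡L = suc-injective (≡.trans 1+s≡L (≡.sym 1+t≡L))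
    ... | inj₂ 1+s≡L | inj₁ 1+t<L =
      ⊥-elim (0≢1+n (simple nonempty 1+t<L (≡.trans (≡.sym closed) (≡.trans (≡.cong h (≡.sym 1+s≡L)) e))))
    ... | inj₁ 1+s<L | inj₂ 1+t≡L =
      ⊥-elim (0≢1+n (simple nonempty 1+s<L (≡.trans (≡.sym closed) (≡.trans (≡.cong h (≡.sym 1+t≡L)) (≡.sym e)))))

    vertex-successor : ∀ {t} → t < L → Successor (h t)
    vertex-successor {suc t} 1+t<L = t , <⇒≤ 1+t<L , ≡.refl
    vertex-successor {zero}  _     = pred L , pred-L<L , ≡.trans (≡.sym closed) (≡.cong h (≡.sym 1+pred-L≡L))
      where
      instance _ = >-nonZero nonempty
      1+pred-L≡L : suc (pred L) ≡ L
      1+pred-L≡L = suc-pred L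
      pred-L<L : pred L < L
      pred-L<L = ≡.subst (pred L <_) 1+pred-L≡L (n<1+n (pred L))

    successor-vertex : ∀ {t} → t < L → ∃ λ s → s < L × h (suc t) ≡ h s
    successor-vertex {t} t<L with m≤n⇒m<n∨m≡n t<L
    ... | inj₁ 1+t<L = suc t , 1+t<L , ≡.refl
    ... | inj₂ 1+t≡L = 0 , nonempty , ≡.trans (≡.cong h 1+t≡L) closed

    partner-colour : ∀ {x} → Partner x → colour x ≢ colour (h 0)
    partner-colour (t , t<L , ≡.refl) e =
      proper (h t) (m (h t)) (m-adjacent (h t)) (≡.trans (colour-along (<⇒≤ t<L)) (≡.sym e))

    successor-colour : ∀ {x} → Successor x → colour x ≡ colour (h 0)
    successor-colour (t , t<L , ≡.refl) = colour-along t<L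

    partner? : ∀ x → Dec (Partner x)
    partner? x = anyUpTo? (λ t → x ≟ m (h t)) L

    successor? : ∀ x → Dec (Successor x)
    successor? x = anyUpTo? (λ t → x ≟ h (suc t)) L

    exchange : Fin n → Fin n
    exchange x with partner? x | successor? x
    ... | yes (t , _) | _           = h (suc t)
    ... | no _        | yes (t , _) = m (h t)
    ... | no _        | no _        = m x

    exchange-partner : ∀ {t} → t < L → exchange (m (h t)) ≡ h (suc t)
    exchange-partner {t} t<L with partner? (m (h t))
    ... | yes (s , s<L , e) = ≡.cong (λ r → h (suc r)) (partner-injective s<L t<L (≡.sym e))
    ... | no ¬partner       = ⊥-elim (¬partner (t , t<L , ≡.refl))

    exchange-successor : ∀ {t} → t < L → exchange (h (suc t)) ≡ m (h t)
    exchange-successor {t} t<L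
      with partner? (h (suc t)) | successor? (h (suc t))
    ... | yes partner | _                   = ⊥-elim (partner-colour partner (successor-colour (t , t<L , ≡.refl)))
    ... | no _        | yes (s , s<L , e)   = ≡.cong (λ r → m (h r)) (successor-injective s<L t<L (≡.sym e))
    ... | no _        | no ¬successor       = ⊥-elim (¬successor (t , t<L , ≡.refl))

    exchange-elsewhere : ∀ {x} → ¬ Partner x → ¬ Successor x → exchange x ≡ m x
    exchange-elsewhere {x} ¬partner ¬successor
      with partner? x | successor? x
    ... | yes partner | _             = ⊥-elim (¬partner partner)
    ... | no _        | yes successor = ⊥-elim (¬successor successor)
    ... | no _        | no _          = ≡.refl

    m-preserves-elsewhere : ∀ {x} → ¬ Partner x → ¬ Successor x → ¬ Partner (m x) × ¬ Successor (m x)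
    m-preserves-elsewhere {x} ¬partner ¬successor = ¬partner′ , ¬successor′
      where
      ¬partner′ : ¬ Partner (m x)
      ¬partner′ (t , t<L , mx≡mht) with vertex-successor t<L
      ... | s , s<L , ht≡hs = ¬successor (s , s<L , ≡.trans (m-injective mx≡mht) ht≡hs)
      ¬successor′ : ¬ Successor (m x)
      ¬successor′ (t , t<L , mx≡ht) with successor-vertex t<L
      ... | s , s<L , ht≡hs = ¬partner (s , s<L , ≡.trans (≡.sym (m-involutive x)) (≡.cong m (≡.trans mx≡ht ht≡hs)))

    involutive-cases : ∀ x → Dec (Partner x) → Dec (Successor x) → exchange (exchange x) ≡ x
    involutive-cases _ (yes (t , t<L , ≡.refl)) _ =
      ≡.trans (≡.cong exchange (exchange-partner t<L)) (exchange-successor t<L)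
    involutive-cases _ (no _) (yes (t , t<L , ≡.refl)) =
      ≡.trans (≡.cong exchange (exchange-successor t<L)) (exchange-partner t<L)
    involutive-cases x (no ¬partner) (no ¬successor) with m-preserves-elsewhere ¬partner ¬successor
    ... | ¬partner′ , ¬successor′ =
      ≡.trans (≡.cong exchange (exchange-elsewhere ¬partner ¬successor))
              (≡.trans (exchange-elsewhere ¬partner′ ¬successor′) (m-involutive x))

    adjacent-cases : ∀ x → Dec (Partner x) → Dec (Successor x) → Adj X x (exchange x)
    adjacent-cases _ (yes (t , t<L , ≡.refl)) _ =
      ≡.subst (Adj X (m (h t))) (≡.sym (exchange-partner t<L)) (proj₂ (step t<L))
    adjacent-cases _ (no _) (yes (t , t<L , ≡.refl)) =
      ≡.subst (Adj X (h (suc t))) (≡.sym (exchange-successor t<L)) (Adj-sym X (proj₂ (step t<L)))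
    adjacent-cases x (no ¬partner) (no ¬successor) =
      ≡.subst (Adj X x) (≡.sym (exchange-elsewhere ¬partner ¬successor)) (m-adjacent x)

    exchange-isPerfectMatching : IsPerfectMatching X exchange
    exchange-isPerfectMatching =
      (λ x → involutive-cases x (partner? x) (successor? x)) , (λ x → adjacent-cases x (partner? x) (successor? x))

    exchange≢m : exchange (m (h 0)) ≢ m (m (h 0))
    exchange≢m e = proj₁ (step nonempty)
      (≡.trans (≡.sym (exchange-partner nonempty)) (≡.trans e (m-involutive (h 0))))

  no-alternatingCycle : ¬ SimpleCycle (AlternatingStep X m)
  no-alternatingCycle cycle = exchange≢m (unique exchange exchange-isPerfectMatching (m (SimpleCycle.vertex cycle 0)))
    where open Exchange cycle

module HermitianAdjacency {c ℓ : Level} (R : CommutativeRing c ℓ) (C : Conjugation R)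
  (α : CommutativeRing.Carrier R)
  (α-unimodular : CommutativeRing._≈_ R (CommutativeRing._*_ R α (Conjugation.conj C α)) (CommutativeRing.1# R))
  {n : ℕ} (X : MixedGraph n) where

  open CommutativeRing R
  open Conjugation C using (conj)
  open Matrices R
  open MatrixAlgebra R
  open import Algebra.Properties.Ring ring using (-0#≈0#)

  H : Matrix n
  H = hermAdj C α X

  hermAdj-vanishes : VanishesOff H (Adj X)
  hermAdj-vanishes {u} {v} ¬adj with edge X u v
  ... | none   = refl
  ... | digon  = ⊥-elim (¬adj λ ())
  ... | arcOut = ⊥-elim (¬adj λ ())
  ... | arcIn  = ⊥-elim (¬adj λ ())

  hermAdj-unimodular : ∀ {u v} → Adj X u v → H u v * H v u ≈ 1#
  hermAdj-unimodular {u} {v} adj rewrite symmetric X u v with edge X u v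
  ... | none   = ⊥-elim (adj ≡.refl)
  ... | digon  = *-identityˡ 1#
  ... | arcOut = α-unimodular
  ... | arcIn  = trans (*-comm (conj α) α) α-unimodular

  hermAdj-inverse-diagonal : Bipartite X → (M : Matrix n) → IsInverse H M → ∀ i → M i i ≈ 0#
  hermAdj-inverse-diagonal (colour , proper) M H⁻¹ i =
    inverse-vanishes-off-separated colour H-vanishes H⁻¹ (λ separated → separated ≡.refl)
    where
    H-vanishes : VanishesOff H (Separates colour)
    H-vanishes ¬separated = hermAdj-vanishes (λ adj → ¬separated (proper _ _ adj))

  module MatchingSplit (m : Fin n → Fin n) (matching : IsPerfectMatching X m) where

    m-involutive : ∀ u → m (m u) ≡ u
    m-involutive = proj₁ matching

    m-adjacent : ∀ u → Adj X u (m u)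
    m-adjacent = proj₂ matching

    D E : Matrix n
    D u v with v ≟ m u
    ... | yes _ = H u v
    ... | no  _ = 0#
    E u v with v ≟ m u
    ... | yes _ = 0#
    ... | no  _ = H u v

    H≈D⊕E : H ≈ₘ (D ⊕ E)
    H≈D⊕E u v with v ≟ m u
    ... | yes _ = sym (+-identityʳ (H u v))
    ... | no  _ = sym (+-identityˡ (H u v))

    D-on : ∀ {u v} → v ≡ m u → D u v ≈ H u v
    D-on {u} {v} v≡mu with v ≟ m u
    ... | yes _   = refl
    ... | no v≢mu = ⊥-elim (v≢mu v≡mu)

    D-off : ∀ {u v} → v ≢ m u → D u v ≈ 0#
    D-off {u} {v} v≢mu with v ≟ m u
    ... | yes v≡mu = ⊥-elim (v≢mu v≡mu)
    ... | no _     = refl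

    E-on : ∀ {u v} → v ≡ m u → E u v ≈ 0#
    E-on {u} {v} v≡mu with v ≟ m u
    ... | yes _   = refl
    ... | no v≢mu = ⊥-elim (v≢mu v≡mu)

    E-off : ∀ {u v} → v ≢ m u → E u v ≈ H u v
    E-off {u} {v} v≢mu with v ≟ m u
    ... | yes v≡mu = ⊥-elim (v≢mu v≡mu)
    ... | no _     = refl

    D⊗-row : ∀ (A : Matrix n) u v → (D ⊗ A) u v ≈ H u (m u) * A (m u) v
    D⊗-row A u v = trans (⊗-sparseˡ D A (m u) (λ _ → D-off) v) (*-congʳ (D-on ≡.refl))

    D⊗D≈I : (D ⊗ D) ≈ₘ I
    D⊗D≈I u v with v ≟ u
    ... | yes ≡.refl = begin
      (D ⊗ D) v v                ≈⟨ D⊗-row D v v ⟩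
      H v (m v) * D (m v) v      ≈⟨ *-congˡ (D-on (≡.sym (m-involutive v))) ⟩
      H v (m v) * H (m v) v      ≈⟨ hermAdj-unimodular (m-adjacent v) ⟩
      1#                         ≈⟨ I-diagonal v ⟨
      I v v                      ∎
      where open import Relation.Binary.Reasoning.Setoid setoid
    ... | no v≢u = begin
      (D ⊗ D) u v                ≈⟨ D⊗-row D u v ⟩
      H u (m u) * D (m u) v      ≈⟨ *-congˡ (D-off (λ v≡mmu → v≢u (≡.trans v≡mmu (m-involutive u)))) ⟩
      H u (m u) * 0#             ≈⟨ zeroʳ (H u (m u)) ⟩
      0#                         ≈⟨ I-off-diagonal (λ u≡v → v≢u (≡.sym u≡v)) ⟨
      I u v                      ∎
      where open import Relation.Binary.Reasoning.Setoid setoid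

    K : Matrix n
    K u v = - (D ⊗ E) u v

    alternatingStep? : ∀ u v → Dec (AlternatingStep X m u v)
    alternatingStep? u v = ¬? (v ≟ u) ×-dec adjacent? X (m u) v

    K-vanishes : VanishesOff K (AlternatingStep X m)
    K-vanishes {u} {w} ¬alternating =
      trans (-‿cong (trans (D⊗-row E u w) (trans (*-congˡ E≈0) (zeroʳ (H u (m u)))))) -0#≈0#
      where
      E≈0 : E (m u) w ≈ 0#
      E≈0 with w ≟ u
      ... | yes w≡u = E-on (≡.trans w≡u (≡.sym (m-involutive u)))
      ... | no w≢u  = trans (E-off (λ w≡mmu → w≢u (≡.trans w≡mmu (m-involutive u))))
                            (hermAdj-vanishes (λ adj → ¬alternating (w≢u , adj)))

  hermAdj-invertible : Bipartite X → HasUniquePerfectMatching X → Σ (Matrix n) (IsInverse H)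
  hermAdj-invertible bipartite (m , matching , unique) =
    geometric K n ⊗ D ,
    Inverses-cong (λ u v → sym (H≈D⊕E u v)) (involution+nilpotent⇒invertible {d = D} {e = E} n D⊗D≈I Kⁿ≈0)
    where
    open MatchingSplit m matching
    open AlternatingCycles X bipartite m matching unique using (no-alternatingCycle)

    Kⁿ≈0 : ∀ u v → (K ^ n) u v ≈ 0#
    Kⁿ≈0 u v = ^-vanishes-off-walks alternatingStep? K-vanishes n
                 (λ walk → no-alternatingCycle (walk⇒simpleCycle walk))

theorem5 : {c ℓ : Level} (R : CommutativeRing c ℓ) (C : Conjugation R)
    (α : CommutativeRing.Carrier R) →
    CommutativeRing._≈_ R (CommutativeRing._*_ R α (Conjugation.conj C α)) (CommutativeRing.1# R) →
    {n : ℕ} (X : MixedGraph n) → Bipartite X → HasUniquePerfectMatching X →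
    Σ (Matrices.Matrix R n) (λ M → Matrices.IsInverse R (Matrices.hermAdj R C α X) M) ×
    ((M : Matrices.Matrix R n) → Matrices.IsInverse R (Matrices.hermAdj R C α X) M →
    ∀ i → CommutativeRing._≈_ R (M i i) (CommutativeRing.0# R))
theorem5 R C α α-unimodular X bipartite uniqueMatching =
  hermAdj-invertible bipartite uniqueMatching , hermAdj-inverse-diagonal bipartite
  where open HermitianAdjacency R C α α-unimodular X
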